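{- Let $m\geq 2$ and $n\geq 1$ be integers, let $\ell$ be an integer with $1\leq\ell\leq m+n-1$, and let $R\in\mathbb{Z}[c]$. Define $$H=R\,a_\ell\prod_{j=\ell}^{m+n-2}a_j\in\mathbb{Z}[c].$$ If $\deg R\leq\min\{2^{m+n-2}-2^{m-2}-2,\;2^\ell-3\}$, then $\overline{H}(0)=0$.
   Context: $a_i=a_i(c)\in\mathbb{Z}[c]$ is defined by $a_0=0$ and $a_i=a_{i-1}^2+c$ for $i\geq1$; $a_i$ is monic of degree $2^{i-1}$ for $i\geq 1$ and vanishes at $c=0$. For fixed $m\geq2$, $n\geq1$ and any $F\in\mathbb{Z}[c]$, $\overline{F}\in\mathbb{Z}[c]$ denotes the remainder of $F$ upon division by the monic polynomial $(a_{m+n-1}+a_{m-1})/c\in\mathbb{Z}[c]$. An empty product is $1$. -}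

module Defs where

open import Data.Nat as ℕ using (ℕ; zero; suc; _∸_)
open import Data.Integer as ℤ using (ℤ; +_; _<_)
open import Data.List using (List; []; _∷_; map; length)
open import Relation.Binary.PropositionalEquality using (_≡_)
open import Relation.Nullary using (yes; no)
open import Data.Product using (Σ; _×_)

-- Polynomials in ℤ[c] as coefficient lists, lowest degree first.
-- Trailing zeros are allowed; equality of polynomials is coefficientwise.
Poly : Set
Poly = List ℤ

coeff : Poly → ℕ → ℤ
coeff []      _       = + 0
coeff (x ∷ p) zero    = x
coeff (x ∷ p) (suc k) = coeff p k

_≈P_ : Poly → Poly → Set
p ≈P q = ∀ k → coeff p k ≡ coeff q k

infixl 6 _+P_
infixl 7 _*P_

_+P_ : Poly → Poly → Poly
[]      +P q       = q
(x ∷ p) +P []      = x ∷ p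
(x ∷ p) +P (y ∷ q) = (x ℤ.+ y) ∷ (p +P q)

scaleP : ℤ → Poly → Poly
scaleP a p = map (a ℤ.*_) p

_*P_ : Poly → Poly → Poly
[]      *P q = []
(x ∷ p) *P q = scaleP x q +P (+ 0 ∷ (p *P q))

X : Poly
X = + 0 ∷ + 1 ∷ []

a : ℕ → Poly
a zero    = []
a (suc i) = a i *P a i +P X

prodA : ℕ → ℕ → Poly
prodA l zero    = + 1 ∷ []
prodA l (suc k) = a l *P prodA (suc l) k

-- ∏_{j=l}^{u} a_j (empty, i.e. = 1, when u < l)
prodRange : ℕ → ℕ → Poly
prodRange l u = prodA l (suc u ∸ l)

-- division by c of a polynomial with zero constant term: drop the constant coefficient
divC : Poly → Poly
divC []      = []
divC (_ ∷ p) = p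

D : ℕ → ℕ → Poly
D m n = divC (a (m ℕ.+ n ∸ 1) +P a (m ∸ 1))

trim : Poly → Poly
trim [] = []
trim (x ∷ p) with trim p
... | y ∷ q = x ∷ y ∷ q
... | [] with x ℤ.≟ + 0
...   | yes _ = []
...   | no  _ = x ∷ []

-- degree of a nonzero polynomial (0 for the zero polynomial; only used for D)
natDeg : Poly → ℕ
natDeg p = length (trim p) ∸ 1

-- deg p ≤ d, for an integer d (deg 0 = -∞)
DegLe : Poly → ℤ → Set
DegLe p d = ∀ (k : ℕ) → d < + k → coeff p k ≡ + 0

DegLt : Poly → ℕ → Set
DegLt p N = ∀ (k : ℕ) → N ℕ.≤ k → coeff p k ≡ + 0

IsRemainder : Poly → Poly → Poly → Set
IsRemainder F G r = Σ Poly (λ Q → F ≈P (Q *P G +P r)) × DegLt r (natDeg G)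

module Submission where

-- Unrolling a_{j+1} = a_j² + c from j = l up to j = m+n−2 gives the telescoping identity
--   a_l ∏_{j=l}^{m+n-2} a_j + c S = a_{m+n−1},   S = Σ_{i≥1} ∏_{j=l+i}^{m+n-2} a_j,
-- hence H + (R a_{m−1} + c R S) = R c D, where D = (a_{m+n−1} + a_{m−1})/c is monic of degree
-- 2^{m+n−2} − 1. The degree bound on R makes the correction R a_{m−1} + c R S of degree < deg D,
-- so by uniqueness of division by a monic polynomial H̄ = −(R a_{m−1} + c R S), which vanishes at
-- c = 0 because every a_i does.

open import Defs
open import Data.Nat as ℕ using (ℕ; zero; suc; z≤n; s≤s)
import Data.Nat.Properties as ℕP
open import Data.Integer as ℤ using (ℤ; +_; -_; -[1+_]; +≤+; +<+; -<+)
import Data.Integer.Properties as ℤP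
open import Data.Integer.Tactic.RingSolver using (solve-∀)
open import Data.List using ([]; _∷_; map; length)
open import Function using (_∘_)
open import Relation.Binary.PropositionalEquality
  using (_≡_; refl; sym; trans; cong; cong₂; subst; _≗_; module ≡-Reasoning)
import Relation.Binary.Reasoning.Setoid as ≈-Reasoning

module Convolution where

  open import Data.Integer using (_+_; _*_)

  infixl 7 _⋆_

  -- The Cauchy product, with the recursion of _*P_, so that coeff-*P is a structural induction.

  _⋆_ : (ℕ → ℤ) → (ℕ → ℤ) → ℕ → ℤ
  (f ⋆ g) zero    = f 0 * g 0
  (f ⋆ g) (suc k) = f 0 * g (suc k) + (f ∘ suc ⋆ g) k

  VanishesAbove : (ℕ → ℤ) → ℕ → Set
  VanishesAbove f n = ∀ j → n ℕ.< j → f j ≡ + 0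

  ⋆-cong : ∀ {f f′ g g′} → f ≗ f′ → g ≗ g′ → f ⋆ g ≗ f′ ⋆ g′
  ⋆-cong ef eg zero    = cong₂ _*_ (ef 0) (eg 0)
  ⋆-cong ef eg (suc k) = cong₂ _+_ (cong₂ _*_ (ef 0) (eg (suc k))) (⋆-cong (ef ∘ suc) eg k)

  ⋆-zeroˡ : ∀ {f} g → (∀ j → f j ≡ + 0) → ∀ k → (f ⋆ g) k ≡ + 0
  ⋆-zeroˡ g f≡0 zero    rewrite f≡0 0 = refl
  ⋆-zeroˡ g f≡0 (suc k) rewrite f≡0 0 | ⋆-zeroˡ g (f≡0 ∘ suc) k = refl

  ⋆-zeroʳ : ∀ f {g} → (∀ j → g j ≡ + 0) → ∀ k → (f ⋆ g) k ≡ + 0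
  ⋆-zeroʳ f g≡0 zero    rewrite g≡0 0 = ℤP.*-zeroʳ (f 0)
  ⋆-zeroʳ f g≡0 (suc k) rewrite g≡0 (suc k) | ⋆-zeroʳ (f ∘ suc) g≡0 k | ℤP.*-zeroʳ (f 0) = refl

  ⋆-constˡ : ∀ f g → VanishesAbove f 0 → ∀ k → (f ⋆ g) k ≡ f 0 * g k
  ⋆-constˡ f g f≡0 zero    = refl
  ⋆-constˡ f g f≡0 (suc k) rewrite ⋆-zeroˡ g (λ j → f≡0 (suc j) (s≤s z≤n)) k = ℤP.+-identityʳ _

  ⋆-distribʳ : ∀ f f′ g → (λ j → f j + f′ j) ⋆ g ≗ (λ k → (f ⋆ g) k + (f′ ⋆ g) k)
  ⋆-distribʳ f f′ g zero    = ℤP.*-distribʳ-+ (g 0) (f 0) (f′ 0)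
  ⋆-distribʳ f f′ g (suc k) rewrite ⋆-distribʳ (f ∘ suc) (f′ ∘ suc) g k =
    lemma (f 0) (f′ 0) (g (suc k)) _ _
    where
    lemma : ∀ a b c d e → (a + b) * c + (d + e) ≡ (a * c + d) + (b * c + e)
    lemma = solve-∀

  ⋆-distribˡ : ∀ f g g′ → f ⋆ (λ j → g j + g′ j) ≗ (λ k → (f ⋆ g) k + (f ⋆ g′) k)
  ⋆-distribˡ f g g′ zero    = ℤP.*-distribˡ-+ (f 0) (g 0) (g′ 0)
  ⋆-distribˡ f g g′ (suc k) rewrite ⋆-distribˡ (f ∘ suc) g g′ k =
    lemma (f 0) (g (suc k)) (g′ (suc k)) _ _
    where
    lemma : ∀ a b c d e → a * (b + c) + (d + e) ≡ (a * b + d) + (a * c + e)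
    lemma = solve-∀

  ⋆-scaleˡ : ∀ c f g → (λ j → c * f j) ⋆ g ≗ (λ k → c * (f ⋆ g) k)
  ⋆-scaleˡ c f g zero    = ℤP.*-assoc c (f 0) (g 0)
  ⋆-scaleˡ c f g (suc k) rewrite ⋆-scaleˡ c (f ∘ suc) g k = lemma c (f 0) (g (suc k)) _
    where
    lemma : ∀ c a b d → c * a * b + c * d ≡ c * (a * b + d)
    lemma = solve-∀

  ⋆-unfoldʳ : ∀ f g k → (f ⋆ g) (suc k) ≡ (f ⋆ g ∘ suc) k + f (suc k) * g 0
  ⋆-unfoldʳ f g zero    = refl
  ⋆-unfoldʳ f g (suc k) rewrite ⋆-unfoldʳ (f ∘ suc) g k =
    sym (ℤP.+-assoc (f 0 * g (suc (suc k))) _ (f (suc (suc k)) * g 0))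

  ⋆-comm : ∀ f g → f ⋆ g ≗ g ⋆ f
  ⋆-comm f g zero    = ℤP.*-comm (f 0) (g 0)
  ⋆-comm f g (suc k) rewrite ⋆-comm (f ∘ suc) g k | ⋆-unfoldʳ g f k
                           | ℤP.*-comm (f 0) (g (suc k)) = ℤP.+-comm (g (suc k) * f 0) _

  ⋆-assoc : ∀ f g h → (f ⋆ g) ⋆ h ≗ f ⋆ (g ⋆ h)
  ⋆-assoc f g h zero    = ℤP.*-assoc (f 0) (g 0) (h 0)
  ⋆-assoc f g h (suc k) = begin
      f 0 * g 0 * h (suc k) + ((λ j → (f ⋆ g) (suc j)) ⋆ h) k
    ≡⟨ cong (_+_ (f 0 * g 0 * h (suc k))) tail ⟩
      f 0 * g 0 * h (suc k) + (f 0 * (g ∘ suc ⋆ h) k + (f ∘ suc ⋆ (g ⋆ h)) k)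
    ≡⟨ lemma (f 0) (g 0) (h (suc k)) _ _ ⟩
      f 0 * (g 0 * h (suc k) + (g ∘ suc ⋆ h) k) + (f ∘ suc ⋆ (g ⋆ h)) k
    ∎
    where
    open ≡-Reasoning
    lemma : ∀ a b c d e → a * b * c + (a * d + e) ≡ a * (b * c + d) + e
    lemma = solve-∀
    tail : ((λ j → (f ⋆ g) (suc j)) ⋆ h) k ≡ f 0 * (g ∘ suc ⋆ h) k + (f ∘ suc ⋆ (g ⋆ h)) k
    tail = begin
        ((λ j → (f ⋆ g) (suc j)) ⋆ h) k
      ≡⟨ ⋆-distribʳ (λ j → f 0 * g (suc j)) (f ∘ suc ⋆ g) h k ⟩
        ((λ j → f 0 * g (suc j)) ⋆ h) k + ((f ∘ suc ⋆ g) ⋆ h) k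
      ≡⟨ cong₂ _+_ (⋆-scaleˡ (f 0) (g ∘ suc) h k) (⋆-assoc (f ∘ suc) g h k) ⟩
        f 0 * (g ∘ suc ⋆ h) k + (f ∘ suc ⋆ (g ⋆ h)) k
      ∎

  ⋆-vanishesAbove : ∀ {f g} m n → VanishesAbove f m → VanishesAbove g n →
                    VanishesAbove (f ⋆ g) (m ℕ.+ n)
  ⋆-vanishesAbove {f} {g} zero n f≡0 g≡0 k n<k
    rewrite ⋆-constˡ f g f≡0 k | g≡0 k n<k = ℤP.*-zeroʳ (f 0)
  ⋆-vanishesAbove {f} {g} (suc m) n f≡0 g≡0 (suc k) (s≤s m+n<k)
    rewrite g≡0 (suc k) (s≤s (ℕP.≤-trans (ℕP.m≤n+m n m) (ℕP.<⇒≤ m+n<k)))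
          | ⋆-vanishesAbove m n (λ j → f≡0 (suc j) ∘ s≤s) g≡0 k m+n<k
          | ℤP.*-zeroʳ (f 0) = refl

  ⋆-top : ∀ {f g} m n → VanishesAbove f m → VanishesAbove g n →
          (f ⋆ g) (m ℕ.+ n) ≡ f m * g n
  ⋆-top {f} {g} zero    n f≡0 g≡0 = ⋆-constˡ f g f≡0 n
  ⋆-top {f} {g} (suc m) n f≡0 g≡0
    rewrite g≡0 (suc (m ℕ.+ n)) (s≤s (ℕP.m≤n+m n m))
          | ⋆-top m n (λ j → f≡0 (suc j) ∘ s≤s) g≡0
          | ℤP.*-zeroʳ (f 0) = ℤP.+-identityˡ _

module Polynomial where

  open import Data.Integer using (_+_; _*_)
  open import Data.Product using (_,_)
  open import Algebra.Structures {A = Poly} _≈P_ using (IsCommutativeRing)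
  open import Algebra.Bundles using (CommutativeRing)
  open import Data.Maybe using (Maybe; just; nothing)
  open import Relation.Nullary using (yes)
  open import Tactic.RingSolver.Core.AlmostCommutativeRing using (fromCommutativeRing)
  import Tactic.RingSolver.NonReflective
  open Convolution

  negP : Poly → Poly
  negP = map -_

  1P : Poly
  1P = + 1 ∷ []

  coeff-+P : ∀ p q → coeff (p +P q) ≗ λ k → coeff p k + coeff q k
  coeff-+P []      q       k       = sym (ℤP.+-identityˡ (coeff q k))
  coeff-+P (x ∷ p) []      k       = sym (ℤP.+-identityʳ (coeff (x ∷ p) k))
  coeff-+P (x ∷ p) (y ∷ q) zero    = refl
  coeff-+P (x ∷ p) (y ∷ q) (suc k) = coeff-+P p q k

  coeff-scaleP : ∀ c p → coeff (scaleP c p) ≗ λ k → c * coeff p k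
  coeff-scaleP c []      k       = sym (ℤP.*-zeroʳ c)
  coeff-scaleP c (x ∷ p) zero    = refl
  coeff-scaleP c (x ∷ p) (suc k) = coeff-scaleP c p k

  coeff-negP : ∀ p → coeff (negP p) ≗ λ k → - coeff p k
  coeff-negP []      k       = refl
  coeff-negP (x ∷ p) zero    = refl
  coeff-negP (x ∷ p) (suc k) = coeff-negP p k

  coeff-∷-*P : ∀ x p q → coeff ((x ∷ p) *P q) ≗ λ k → x * coeff q k + coeff (+ 0 ∷ p *P q) k
  coeff-∷-*P x p q k = trans (coeff-+P (scaleP x q) _ k) (cong (_+ coeff (+ 0 ∷ p *P q) k) (coeff-scaleP x q k))

  coeff-*P : ∀ p q → coeff (p *P q) ≗ coeff p ⋆ coeff q
  coeff-*P []      q k       = sym (⋆-zeroˡ (coeff q) (λ _ → refl) k)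
  coeff-*P (x ∷ p) q zero    = trans (coeff-∷-*P x p q 0) (ℤP.+-identityʳ _)
  coeff-*P (x ∷ p) q (suc k) = trans (coeff-∷-*P x p q (suc k)) (cong (_+_ (x * coeff q (suc k))) (coeff-*P p q k))

  +P-cong : ∀ {p p′ q q′} → p ≈P p′ → q ≈P q′ → (p +P q) ≈P (p′ +P q′)
  +P-cong {p} {p′} {q} {q′} p≈ q≈ k =
    trans (coeff-+P p q k) (trans (cong₂ _+_ (p≈ k) (q≈ k)) (sym (coeff-+P p′ q′ k)))

  *P-cong : ∀ {p p′ q q′} → p ≈P p′ → q ≈P q′ → (p *P q) ≈P (p′ *P q′)
  *P-cong {p} {p′} {q} {q′} p≈ q≈ k =
    trans (coeff-*P p q k) (trans (⋆-cong p≈ q≈ k) (sym (coeff-*P p′ q′ k)))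

  negP-cong : ∀ {p p′} → p ≈P p′ → negP p ≈P negP p′
  negP-cong {p} {p′} p≈ k = trans (coeff-negP p k) (trans (cong -_ (p≈ k)) (sym (coeff-negP p′ k)))

  +P-assoc : ∀ p q r → ((p +P q) +P r) ≈P (p +P (q +P r))
  +P-assoc p q r k = begin
    coeff ((p +P q) +P r) k                   ≡⟨ coeff-+P (p +P q) r k ⟩
    coeff (p +P q) k + coeff r k              ≡⟨ cong (_+ coeff r k) (coeff-+P p q k) ⟩
    coeff p k + coeff q k + coeff r k         ≡⟨ ℤP.+-assoc (coeff p k) (coeff q k) (coeff r k) ⟩
    coeff p k + (coeff q k + coeff r k)       ≡⟨ cong (_+_ (coeff p k)) (coeff-+P q r k) ⟨
    coeff p k + coeff (q +P r) k              ≡⟨ coeff-+P p (q +P r) k ⟨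
    coeff (p +P (q +P r)) k                   ∎
    where open ≡-Reasoning

  +P-comm : ∀ p q → (p +P q) ≈P (q +P p)
  +P-comm p q k =
    trans (coeff-+P p q k) (trans (ℤP.+-comm (coeff p k) (coeff q k)) (sym (coeff-+P q p k)))

  +P-identityʳ : ∀ p → (p +P []) ≈P p
  +P-identityʳ p k = trans (coeff-+P p [] k) (ℤP.+-identityʳ (coeff p k))

  +P-inverseˡ : ∀ p → (negP p +P p) ≈P []
  +P-inverseˡ p k = trans (coeff-+P (negP p) p k)
    (trans (cong (_+ coeff p k) (coeff-negP p k)) (ℤP.+-inverseˡ (coeff p k)))

  +P-inverseʳ : ∀ p → (p +P negP p) ≈P []
  +P-inverseʳ p k = trans (+P-comm p (negP p) k) (+P-inverseˡ p k)

  *P-assoc : ∀ p q r → ((p *P q) *P r) ≈P (p *P (q *P r))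
  *P-assoc p q r k = begin
    coeff ((p *P q) *P r) k                    ≡⟨ coeff-*P (p *P q) r k ⟩
    (coeff (p *P q) ⋆ coeff r) k               ≡⟨ ⋆-cong (coeff-*P p q) (λ _ → refl) k ⟩
    ((coeff p ⋆ coeff q) ⋆ coeff r) k          ≡⟨ ⋆-assoc (coeff p) (coeff q) (coeff r) k ⟩
    (coeff p ⋆ (coeff q ⋆ coeff r)) k          ≡⟨ ⋆-cong (λ _ → refl) (coeff-*P q r) k ⟨
    (coeff p ⋆ coeff (q *P r)) k               ≡⟨ coeff-*P p (q *P r) k ⟨
    coeff (p *P (q *P r)) k                    ∎
    where open ≡-Reasoning

  *P-comm : ∀ p q → (p *P q) ≈P (q *P p)
  *P-comm p q k =
    trans (coeff-*P p q k) (trans (⋆-comm (coeff p) (coeff q) k) (sym (coeff-*P q p k)))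

  *P-identityˡ : ∀ p → (1P *P p) ≈P p
  *P-identityˡ p k = trans (coeff-*P 1P p k)
    (trans (⋆-constˡ (coeff 1P) (coeff p) (λ { (suc j) _ → refl }) k) (ℤP.*-identityˡ (coeff p k)))

  *P-identityʳ : ∀ p → (p *P 1P) ≈P p
  *P-identityʳ p k = trans (*P-comm p 1P k) (*P-identityˡ p k)

  *P-distribˡ : ∀ p q r → (p *P (q +P r)) ≈P ((p *P q) +P (p *P r))
  *P-distribˡ p q r k = begin
    coeff (p *P (q +P r)) k                    ≡⟨ coeff-*P p (q +P r) k ⟩
    (coeff p ⋆ coeff (q +P r)) k               ≡⟨ ⋆-cong (λ _ → refl) (coeff-+P q r) k ⟩
    (coeff p ⋆ (λ j → coeff q j + coeff r j)) k ≡⟨ ⋆-distribˡ (coeff p) (coeff q) (coeff r) k ⟩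
    (coeff p ⋆ coeff q) k + (coeff p ⋆ coeff r) k
      ≡⟨ cong₂ _+_ (coeff-*P p q k) (coeff-*P p r k) ⟨
    coeff (p *P q) k + coeff (p *P r) k        ≡⟨ coeff-+P (p *P q) (p *P r) k ⟨
    coeff ((p *P q) +P (p *P r)) k             ∎
    where open ≡-Reasoning

  *P-distribʳ : ∀ p q r → ((q +P r) *P p) ≈P ((q *P p) +P (r *P p))
  *P-distribʳ p q r k = begin
    coeff ((q +P r) *P p) k                    ≡⟨ *P-comm (q +P r) p k ⟩
    coeff (p *P (q +P r)) k                    ≡⟨ *P-distribˡ p q r k ⟩
    coeff ((p *P q) +P (p *P r)) k             ≡⟨ +P-cong {p *P q} {q *P p} {p *P r} {r *P p} (*P-comm p q) (*P-comm p r) k ⟩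
    coeff ((q *P p) +P (r *P p)) k             ∎
    where open ≡-Reasoning

  +P-*P-isCommutativeRing : IsCommutativeRing _+P_ _*P_ negP [] 1P
  +P-*P-isCommutativeRing = record
    { isRing = record
      { +-isAbelianGroup = record
        { isGroup = record
          { isMonoid = record
            { isSemigroup = record
              { isMagma = record
                { isEquivalence = record { refl = λ {p} _ → refl ; sym = λ {p q} p≈q k → sym (p≈q k)
                                         ; trans = λ {p q r} p≈q q≈r k → trans (p≈q k) (q≈r k) }
                ; ∙-cong = λ {p p′ q q′} → +P-cong {p} {p′} {q} {q′} }
              ; assoc = +P-assoc }
            ; identity = (λ _ _ → refl) , +P-identityʳ }
          ; inverse = +P-inverseˡ , +P-inverseʳ
          ; ⁻¹-cong = λ {p p′} → negP-cong {p} {p′} }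
        ; comm = +P-comm }
      ; *-cong = λ {p p′ q q′} → *P-cong {p} {p′} {q} {q′}
      ; *-assoc = *P-assoc
      ; *-identity = *P-identityˡ , *P-identityʳ
      ; distrib = *P-distribˡ , *P-distribʳ }
    ; *-comm = *P-comm }

  +P-*P-commutativeRing : CommutativeRing _ _
  +P-*P-commutativeRing = record { isCommutativeRing = +P-*P-isCommutativeRing }

  module ≈P-Reasoning = ≈-Reasoning (CommutativeRing.setoid +P-*P-commutativeRing)

  coeff-X*P-0 : ∀ q → coeff (X *P q) 0 ≡ + 0
  coeff-X*P-0 q = trans (coeff-∷-*P (+ 0) 1P q 0) (ℤP.*-zeroˡ (coeff q 0))

  coeff-X*P-suc : ∀ q k → coeff (X *P q) (suc k) ≡ coeff q k
  coeff-X*P-suc q k = begin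
    coeff (X *P q) (suc k)                    ≡⟨ coeff-∷-*P (+ 0) 1P q (suc k) ⟩
    + 0 * coeff q (suc k) + coeff (1P *P q) k ≡⟨ cong₂ _+_ (ℤP.*-zeroˡ (coeff q (suc k))) (*P-identityˡ q k) ⟩
    + 0 + coeff q k                           ≡⟨ ℤP.+-identityˡ (coeff q k) ⟩
    coeff q k                                 ∎
    where open ≡-Reasoning

  coeff-divC : ∀ p k → coeff (divC p) k ≡ coeff p (suc k)
  coeff-divC []      k = refl
  coeff-divC (x ∷ p) k = refl

  X*P-divC : ∀ p → coeff p 0 ≡ + 0 → (X *P divC p) ≈P p
  X*P-divC p p₀≡0 zero    = trans (coeff-X*P-0 (divC p)) (sym p₀≡0)
  X*P-divC []      _ (suc k) = coeff-X*P-suc [] k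
  X*P-divC (x ∷ p) _ (suc k) = coeff-X*P-suc p k

  -- A zero test lets the solver cancel p +P negP p, whose normal form has coefficient [+ 0].
  ≟[] : ∀ p → Maybe ([] ≈P p)
  ≟[] []      = just (λ _ → refl)
  ≟[] (x ∷ p) with x ℤ.≟ + 0 | ≟[] p
  ... | yes x≡0 | just p≈[] = just λ { zero → sym x≡0 ; (suc k) → p≈[] k }
  ... | _       | _         = nothing

  module +P-*P-Solver = Tactic.RingSolver.NonReflective (fromCommutativeRing +P-*P-commutativeRing ≟[])

module Degree where

  open import Data.Integer using (_+_; _*_; _≤_; _<_)
  open Convolution
  open Polynomial

  degLe⇒vanishesAbove : ∀ p {n} → DegLe p (+ n) → VanishesAbove (coeff p) n
  degLe⇒vanishesAbove p p≤n j n<j = p≤n j (+<+ n<j)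

  degLe⇒degLt : ∀ p {i N} → DegLe p i → i < + N → DegLt p N
  degLe⇒degLt p p≤i i<N k N≤k = p≤i k (ℤP.<-≤-trans i<N (+≤+ N≤k))

  degLe-mono : ∀ p {i j} → i ≤ j → DegLe p i → DegLe p j
  degLe-mono p i≤j p≤i k j<k = p≤i k (ℤP.≤-<-trans i≤j j<k)

  degLe-[] : ∀ i → DegLe [] i
  degLe-[] i k _ = refl

  degLe-1P : DegLe 1P (+ 0)
  degLe-1P zero    (+<+ ())
  degLe-1P (suc k) _ = refl

  degLe-X : DegLe X (+ 1)
  degLe-X zero          (+<+ ())
  degLe-X (suc zero)    (+<+ (s≤s ()))
  degLe-X (suc (suc k)) _ = refl

  degLe-+P : ∀ p q {i} → DegLe p i → DegLe q i → DegLe (p +P q) i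
  degLe-+P p q p≤i q≤i k i<k = trans (coeff-+P p q k) (cong₂ _+_ (p≤i k i<k) (q≤i k i<k))

  degLe-*P : ∀ p q {i j} → DegLe p i → DegLe q j → DegLe (p *P q) (i + j)
  degLe-*P p q { -[1+ _ ]} p≤i q≤j k _ =
    trans (coeff-*P p q k) (⋆-zeroˡ (coeff q) (λ j → p≤i j -<+) k)
  degLe-*P p q {+ _} { -[1+ _ ]} p≤i q≤j k _ =
    trans (coeff-*P p q k) (⋆-zeroʳ (coeff p) (λ j → q≤j j -<+) k)
  degLe-*P p q {+ m} {+ n} p≤m q≤n k (+<+ m+n<k) =
    trans (coeff-*P p q k)
          (⋆-vanishesAbove m n (degLe⇒vanishesAbove p p≤m) (degLe⇒vanishesAbove q q≤n) k m+n<k)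

  coeff-*P-top : ∀ p q {m n} → DegLe p (+ m) → DegLe q (+ n) →
                 coeff (p *P q) (m ℕ.+ n) ≡ coeff p m * coeff q n
  coeff-*P-top p q {m} {n} p≤m q≤n =
    trans (coeff-*P p q (m ℕ.+ n)) (⋆-top m n (degLe⇒vanishesAbove p p≤m) (degLe⇒vanishesAbove q q≤n))

module Iteration where

  open import Data.Integer using (_+_; _*_; _-_)
  open import Algebra.Bundles using (CommutativeRing)
  open Convolution
  open Polynomial
  open Degree

  2^-suc : ∀ j → 2 ℕ.^ suc j ≡ 2 ℕ.^ j ℕ.+ 2 ℕ.^ j
  2^-suc j = cong (2 ℕ.^ j ℕ.+_) (ℕP.+-identityʳ (2 ℕ.^ j))

  coeff-a-0 : ∀ i → coeff (a i) 0 ≡ + 0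
  coeff-a-0 zero    = refl
  coeff-a-0 (suc i) = begin
    coeff (a i *P a i +P X) 0        ≡⟨ coeff-+P (a i *P a i) X 0 ⟩
    coeff (a i *P a i) 0 + + 0       ≡⟨ ℤP.+-identityʳ _ ⟩
    coeff (a i *P a i) 0             ≡⟨ coeff-*P (a i) (a i) 0 ⟩
    coeff (a i) 0 * coeff (a i) 0    ≡⟨ cong (_* coeff (a i) 0) (coeff-a-0 i) ⟩
    + 0 * coeff (a i) 0              ≡⟨ ℤP.*-zeroˡ (coeff (a i) 0) ⟩
    + 0                              ∎
    where open ≡-Reasoning

  degLe-a : ∀ j → DegLe (a (suc j)) (+ 2 ℕ.^ j)
  degLe-a zero    = degLe-X
  degLe-a (suc j) rewrite 2^-suc j =
    degLe-+P (aⱼ *P aⱼ) X (degLe-*P aⱼ aⱼ (degLe-a j) (degLe-a j))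
             (degLe-mono X (+≤+ (ℕP.+-mono-≤ (ℕP.m^n>0 2 j) z≤n)) degLe-X)
    where
    aⱼ : Poly
    aⱼ = a (suc j)

  coeff-a-top : ∀ j → coeff (a (suc j)) (2 ℕ.^ j) ≡ + 1
  coeff-a-top zero    = refl
  coeff-a-top (suc j) rewrite 2^-suc j = begin
    coeff (aⱼ *P aⱼ +P X) (2 ℕ.^ j ℕ.+ 2 ℕ.^ j)
      ≡⟨ coeff-+P (aⱼ *P aⱼ) X (2 ℕ.^ j ℕ.+ 2 ℕ.^ j) ⟩
    coeff (aⱼ *P aⱼ) (2 ℕ.^ j ℕ.+ 2 ℕ.^ j) + coeff X (2 ℕ.^ j ℕ.+ 2 ℕ.^ j)
      ≡⟨ cong₂ _+_ (coeff-*P-top aⱼ aⱼ (degLe-a j) (degLe-a j)) (degLe-X _ (+<+ 1<2^j+2^j)) ⟩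
    coeff aⱼ (2 ℕ.^ j) * coeff aⱼ (2 ℕ.^ j) + + 0
      ≡⟨ cong (λ c → c * c + + 0) (coeff-a-top j) ⟩
    + 1 ∎
    where
    open ≡-Reasoning
    aⱼ : Poly
    aⱼ = a (suc j)
    1<2^j+2^j : 1 ℕ.< 2 ℕ.^ j ℕ.+ 2 ℕ.^ j
    1<2^j+2^j = ℕP.+-mono-≤ (ℕP.m^n>0 2 j) (ℕP.m^n>0 2 j)

  degLe-prodA : ∀ l k → DegLe (prodA (suc l) k) (+ 2 ℕ.^ (l ℕ.+ k) - + 2 ℕ.^ l)
  degLe-prodA l zero rewrite ℕP.+-identityʳ l | ℤP.+-inverseʳ (+ 2 ℕ.^ l) = degLe-1P
  degLe-prodA l (suc k) =
    subst (DegLe (prodA (suc l) (suc k))) (exponent l k)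
          (degLe-*P (a (suc l)) (prodA (suc (suc l)) k) (degLe-a l) (degLe-prodA (suc l) k))
    where
    cancel : ∀ x y → x + (y - (x + x)) ≡ y - x
    cancel = solve-∀
    exponent : ∀ l k → + 2 ℕ.^ l + (+ 2 ℕ.^ (suc l ℕ.+ k) - + 2 ℕ.^ suc l) ≡ + 2 ℕ.^ (l ℕ.+ suc k) - + 2 ℕ.^ l
    exponent l k rewrite ℕP.+-suc l k | 2^-suc l = cancel (+ 2 ℕ.^ l) (+ 2 ℕ.^ suc (l ℕ.+ k))

  -- sumProdA l k = Σ_{i=1}^{k} ∏_{j=l+i}^{l+k-1} a_j
  sumProdA : ℕ → ℕ → Poly
  sumProdA l zero    = []
  sumProdA l (suc k) = prodA (suc l) k +P sumProdA (suc l) k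

  degLe-sumProdA : ∀ l k → DegLe (sumProdA (suc l) k) (+ 2 ℕ.^ (l ℕ.+ k) - + 2 ℕ.^ suc l)
  degLe-sumProdA l zero    = degLe-[] _
  degLe-sumProdA l (suc k) rewrite ℕP.+-suc l k =
    degLe-+P (prodA (suc (suc l)) k) (sumProdA (suc (suc l)) k)
             (degLe-prodA (suc l) k)
             (degLe-mono (sumProdA (suc (suc l)) k) 2^[2+l]-bound (degLe-sumProdA (suc l) k))
    where
    2^[2+l]-bound : + 2 ℕ.^ suc (l ℕ.+ k) - + 2 ℕ.^ suc (suc l) ℤ.≤ + 2 ℕ.^ suc (l ℕ.+ k) - + 2 ℕ.^ suc l
    2^[2+l]-bound = ℤP.+-monoʳ-≤ (+ 2 ℕ.^ suc (l ℕ.+ k))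
                      (ℤP.neg-mono-≤ (+≤+ (ℕP.^-monoʳ-≤ 2 (ℕP.n≤1+n (suc l)))))

  a-telescope : ∀ l k → (a l *P prodA l k +P X *P sumProdA l k) ≈P a (l ℕ.+ k)
  a-telescope l zero rewrite ℕP.+-identityʳ l = begin
    a l *P 1P +P X *P []   ≈⟨ +-cong {a l *P 1P} {a l} {X *P []} {[]} (*-identityʳ (a l)) (zeroʳ X) ⟩
    a l +P []              ≈⟨ +-identityʳ (a l) ⟩
    a l                    ∎
    where
    open CommutativeRing +P-*P-commutativeRing using (+-cong; *-identityʳ; zeroʳ; +-identityʳ)
    open ≈P-Reasoning
  a-telescope l (suc k) rewrite ℕP.+-suc l k = begin
    a l *P (a l *P P) +P X *P (P +P S)    ≈⟨ solve 4 (λ A P x S → (A ⊗ (A ⊗ P) ⊕ x ⊗ (P ⊕ S)) ⊜ ((A ⊗ A ⊕ x) ⊗ P ⊕ x ⊗ S))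
                                                  (λ _ → refl) (a l) P X S ⟩
    a (suc l) *P P +P X *P S              ≈⟨ a-telescope (suc l) k ⟩
    a (suc l ℕ.+ k)                       ∎
    where
    open ≈P-Reasoning
    open +P-*P-Solver
    P S : Poly
    P = prodA (suc l) k
    S = sumProdA (suc l) k

module Remainder where

  open import Data.Integer using (_+_; _*_)
  open import Data.Product using (_,_)
  open import Data.Empty using (⊥-elim)
  open import Relation.Nullary using (yes; no)
  open import Relation.Binary.PropositionalEquality using (_≢_)
  open import Algebra.Bundles using (CommutativeRing)
  open import Algebra.Properties.AbelianGroup ℤP.+-0-abelianGroup using (inverseʳ-unique)
  open Convolution
  open Polynomial

  trim-≡[] : ∀ p → (∀ k → coeff p k ≡ + 0) → trim p ≡ []
  trim-≡[] []      _   = refl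
  trim-≡[] (x ∷ p) p≡0 with trim p | trim-≡[] p (p≡0 ∘ suc)
  ... | [] | refl with x ℤ.≟ + 0
  ...   | yes _   = refl
  ...   | no  x≢0 = ⊥-elim (x≢0 (p≡0 0))

  length-trim : ∀ p d → DegLt p (suc d) → coeff p d ≢ + 0 → length (trim p) ≡ suc d
  length-trim []      d       _    top≢0 = ⊥-elim (top≢0 refl)
  length-trim (x ∷ p) zero    p<1  top≢0 with trim p | trim-≡[] p (λ k → p<1 (suc k) (s≤s z≤n))
  ... | [] | refl with x ℤ.≟ + 0
  ...   | yes x≡0 = ⊥-elim (top≢0 x≡0)
  ...   | no  _   = refl
  length-trim (x ∷ p) (suc d) p<d+2 top≢0
    with trim p | length-trim p d (λ k d<k → p<d+2 (suc k) (s≤s d<k)) top≢0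
  ... | _ ∷ _ | length≡ = cong suc length≡

  natDeg-monic : ∀ p d → coeff p d ≡ + 1 → DegLt p (suc d) → natDeg p ≡ d
  natDeg-monic p d top≡1 p<d+1 =
    cong (ℕ._∸ 1) (length-trim p d p<d+1 (λ top≡0 → 1≢0 (trans (sym top≡1) top≡0)))
    where
    1≢0 : + 1 ≢ + 0
    1≢0 ()

  degLt-+P : ∀ p q {N} → DegLt p N → DegLt q N → DegLt (p +P q) N
  degLt-+P p q p<N q<N k N≤k = trans (coeff-+P p q k) (cong₂ _+_ (p<N k N≤k) (q<N k N≤k))

  multiple-of-monic : ∀ G d → coeff G d ≡ + 1 → DegLt G (suc d) →
                      ∀ E → DegLt (E *P G) d → ∀ k → coeff E k ≡ + 0
  multiple-of-monic G d top≡1 G<d+1 []      _       k = refl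
  multiple-of-monic G d top≡1 G<d+1 (x ∷ E) xEG<d = coeff-x∷E≡0
    where
    EG<d : DegLt (E *P G) d
    EG<d j d≤j = begin
      coeff (E *P G) j                                 ≡⟨ ℤP.+-identityˡ _ ⟨
      + 0 + coeff (E *P G) j                           ≡⟨ cong (_+ coeff (E *P G) j) x*Gⱼ₊₁≡0 ⟨
      x * coeff G (suc j) + coeff (E *P G) j           ≡⟨ coeff-∷-*P x E G (suc j) ⟨
      coeff ((x ∷ E) *P G) (suc j)                     ≡⟨ xEG<d (suc j) (ℕP.m≤n⇒m≤1+n d≤j) ⟩
      + 0                                              ∎
      where
      open ≡-Reasoning
      x*Gⱼ₊₁≡0 : x * coeff G (suc j) ≡ + 0
      x*Gⱼ₊₁≡0 = trans (cong (x *_) (G<d+1 (suc j) (s≤s d≤j))) (ℤP.*-zeroʳ x)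
    E≡0 : ∀ k → coeff E k ≡ + 0
    E≡0 = multiple-of-monic G d top≡1 G<d+1 E EG<d
    c·EG≡0 : ∀ k → coeff (+ 0 ∷ E *P G) k ≡ + 0
    c·EG≡0 zero    = refl
    c·EG≡0 (suc k) = trans (coeff-*P E G k) (⋆-zeroˡ (coeff G) E≡0 k)
    x≡0 : x ≡ + 0
    x≡0 = begin
      x                                                ≡⟨ ℤP.*-identityʳ x ⟨
      x * + 1                                          ≡⟨ cong (x *_) top≡1 ⟨
      x * coeff G d                                    ≡⟨ ℤP.+-identityʳ _ ⟨
      x * coeff G d + + 0                              ≡⟨ cong (_+_ (x * coeff G d)) (c·EG≡0 d) ⟨
      x * coeff G d + coeff (+ 0 ∷ E *P G) d           ≡⟨ coeff-∷-*P x E G d ⟨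
      coeff ((x ∷ E) *P G) d                           ≡⟨ xEG<d d ℕP.≤-refl ⟩
      + 0                                              ∎
      where open ≡-Reasoning
    coeff-x∷E≡0 : ∀ k → coeff (x ∷ E) k ≡ + 0
    coeff-x∷E≡0 zero    = x≡0
    coeff-x∷E≡0 (suc k) = E≡0 k

  remainder-unique : ∀ F G Q T r d → coeff G d ≡ + 1 → DegLt G (suc d) →
                     IsRemainder F G r → (F +P T) ≈P (Q *P G) → DegLt T d →
                     ∀ k → coeff r k ≡ - coeff T k
  remainder-unique F G Q T r d top≡1 G<d+1 ((Q₁ , F≈Q₁G+r) , r<deg) F+T≈QG T<d k =
    inverseʳ-unique (coeff T k) (coeff r k) (trans (sym (coeff-+P T r k)) (T+r≡0 k))
    where
    open CommutativeRing +P-*P-commutativeRing using (+-cong)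
    open ≈P-Reasoning
    open +P-*P-Solver
    E : Poly
    E = Q +P negP Q₁
    EG≈T+r : (E *P G) ≈P (T +P r)
    EG≈T+r = begin
      E *P G
        ≈⟨ solve 3 (λ Q Q₁ G → ((Q ⊕ ⊝ Q₁) ⊗ G) ⊜ (Q ⊗ G ⊕ ⊝ (Q₁ ⊗ G))) (λ _ → refl) Q Q₁ G ⟩
      Q *P G +P negP (Q₁ *P G)
        ≈⟨ +-cong {Q *P G} {F +P T} {negP (Q₁ *P G)} {negP (Q₁ *P G)} (λ j → sym (F+T≈QG j))
                  (λ _ → refl) ⟩
      (F +P T) +P negP (Q₁ *P G)
        ≈⟨ +-cong {F +P T} {(Q₁ *P G +P r) +P T} {negP (Q₁ *P G)} {negP (Q₁ *P G)}
                  (+-cong {F} {Q₁ *P G +P r} {T} {T} F≈Q₁G+r (λ _ → refl)) (λ _ → refl) ⟩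
      (Q₁ *P G +P r) +P T +P negP (Q₁ *P G)
        ≈⟨ solve 3 (λ A r T → (A ⊕ r ⊕ T ⊕ ⊝ A) ⊜ (T ⊕ r)) (λ _ → refl) (Q₁ *P G) r T ⟩
      T +P r ∎
    r<d : DegLt r d
    r<d = subst (DegLt r) (natDeg-monic G d top≡1 G<d+1) r<deg
    EG<d : DegLt (E *P G) d
    EG<d j d≤j = trans (EG≈T+r j) (degLt-+P T r T<d r<d j d≤j)
    T+r≡0 : ∀ k → coeff (T +P r) k ≡ + 0
    T+r≡0 k = trans (sym (EG≈T+r k))
                    (trans (coeff-*P E G k) (⋆-zeroˡ (coeff G) (multiple-of-monic G d top≡1 G<d+1 E EG<d) k))

-- m = m′ + 2, n = n′ + 1, l = l′ + 1; then e = m + n − 2 and d = 2^e − 1 is the degree of D m n.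
module Reduction (m′ n′ l′ : ℕ) (R : Poly) where

  open import Data.Integer using (_+_; _-_; _≤_; _<_; _⊓_)
  open import Algebra.Bundles using (CommutativeRing)
  open CommutativeRing Polynomial.+P-*P-commutativeRing using (+-cong; *-cong; *-assoc)
  open Polynomial
  open Degree
  open Iteration

  e k d : ℕ
  e = m′ ℕ.+ suc n′
  k = e ℕ.∸ l′
  d = ℕ.pred (2 ℕ.^ e)

  suc-d : suc d ≡ 2 ℕ.^ e
  suc-d = ℕP.suc-pred (2 ℕ.^ e) {{ℕP.m^n≢0 2 e}}

  H : Poly
  H = R *P a (suc l′) *P prodA (suc l′) k

  Dₘₙ : Poly
  Dₘₙ = D (suc (suc m′)) (suc n′)

  correction : Poly
  correction = R *P a (suc m′) +P X *P (R *P sumProdA (suc l′) k)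

  H+correction≈RX*Dₘₙ : l′ ℕ.≤ e → (H +P correction) ≈P ((R *P X) *P Dₘₙ)
  H+correction≈RX*Dₘₙ l′≤e = begin
    R *P Aₗ *P P +P (R *P Aₘ +P X *P (R *P S))
      ≈⟨ solve 6 (λ R Aₗ P Aₘ X S → (R ⊗ Aₗ ⊗ P ⊕ (R ⊗ Aₘ ⊕ X ⊗ (R ⊗ S))) ⊜ (R ⊗ (Aₗ ⊗ P ⊕ X ⊗ S ⊕ Aₘ)))
                 (λ _ → refl) R Aₗ P Aₘ X S ⟩
    R *P (Aₗ *P P +P X *P S +P Aₘ)
      ≈⟨ *-cong {R} {R} {Aₗ *P P +P X *P S +P Aₘ} {X *P Dₘₙ} (λ _ → refl) factor≈X*Dₘₙ ⟩
    R *P (X *P Dₘₙ)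
      ≈⟨ (λ j → sym (*-assoc R X Dₘₙ j)) ⟩
    (R *P X) *P Dₘₙ ∎
    where
    open ≈P-Reasoning
    open +P-*P-Solver
    Aₗ Aₘ P S : Poly
    Aₗ = a (suc l′)
    Aₘ = a (suc m′)
    P = prodA (suc l′) k
    S = sumProdA (suc l′) k
    telescope : (Aₗ *P P +P X *P S) ≈P a (suc e)
    telescope = subst (λ i → (Aₗ *P P +P X *P S) ≈P a (suc i)) (ℕP.m+[n∸m]≡n l′≤e) (a-telescope (suc l′) k)
    X*Dₘₙ≈ : (X *P Dₘₙ) ≈P (a (suc e) +P Aₘ)
    X*Dₘₙ≈ = X*P-divC (a (suc e) +P Aₘ)
             (trans (coeff-+P (a (suc e)) Aₘ 0) (cong₂ _+_ (coeff-a-0 (suc e)) (coeff-a-0 (suc m′))))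
    factor≈X*Dₘₙ : (Aₗ *P P +P X *P S +P Aₘ) ≈P (X *P Dₘₙ)
    factor≈X*Dₘₙ j = trans (+-cong {Aₗ *P P +P X *P S} {a (suc e)} {Aₘ} {Aₘ} telescope (λ _ → refl) j)
                         (sym (X*Dₘₙ≈ j))

  coeff-Dₘₙ : ∀ j → coeff Dₘₙ j ≡ coeff (a (suc e)) (suc j) + coeff (a (suc m′)) (suc j)
  coeff-Dₘₙ j = trans (coeff-divC (a (suc e) +P a (suc m′)) j) (coeff-+P (a (suc e)) (a (suc m′)) (suc j))

  2^m′<2^e : 2 ℕ.^ m′ ℕ.< 2 ℕ.^ e
  2^m′<2^e = ℕP.^-monoʳ-< 2 (s≤s (s≤s z≤n)) (ℕP.m<m+n m′ (s≤s z≤n))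

  coeff-Dₘₙ-top : coeff Dₘₙ d ≡ + 1
  coeff-Dₘₙ-top = begin
    coeff Dₘₙ d                                                       ≡⟨ coeff-Dₘₙ d ⟩
    coeff (a (suc e)) (suc d) + coeff (a (suc m′)) (suc d)           ≡⟨ cong (λ i → coeff (a (suc e)) i + coeff (a (suc m′)) i) suc-d ⟩
    coeff (a (suc e)) (2 ℕ.^ e) + coeff (a (suc m′)) (2 ℕ.^ e)       ≡⟨ cong₂ _+_ (coeff-a-top e) (degLe-a m′ _ (+<+ 2^m′<2^e)) ⟩
    + 1                                                              ∎
    where open ≡-Reasoning

  degLt-Dₘₙ : DegLt Dₘₙ (suc d)
  degLt-Dₘₙ j d<j = trans (coeff-Dₘₙ j) (cong₂ _+_ (degLe-a e (suc j) (+<+ 2^e<1+j))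
                                                 (degLe-a m′ (suc j) (+<+ (ℕP.<-trans 2^m′<2^e 2^e<1+j))))
    where
    2^e<1+j : 2 ℕ.^ e ℕ.< suc j
    2^e<1+j = s≤s (subst (ℕ._≤ j) suc-d d<j)

  coeff-correction-0 : coeff correction 0 ≡ + 0
  coeff-correction-0 = begin
    coeff correction 0                                   ≡⟨ coeff-+P (R *P Aₘ) (X *P (R *P S)) 0 ⟩
    coeff (R *P Aₘ) 0 + coeff (X *P (R *P S)) 0          ≡⟨ cong₂ _+_ (coeff-*P R Aₘ 0) (coeff-X*P-0 (R *P S)) ⟩
    coeff R 0 ℤ.* coeff Aₘ 0 + + 0                      ≡⟨ cong (λ c → coeff R 0 ℤ.* c + + 0) (coeff-a-0 (suc m′)) ⟩
    coeff R 0 ℤ.* + 0 + + 0                              ≡⟨ cong (_+ + 0) (ℤP.*-zeroʳ (coeff R 0)) ⟩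
    + 0                                                  ∎
    where
    open ≡-Reasoning
    Aₘ S : Poly
    Aₘ = a (suc m′)
    S = sumProdA (suc l′) k

  Bound : ℤ
  Bound = ((+ (2 ℕ.^ e) - + (2 ℕ.^ m′)) - + 2) ⊓ (+ (2 ℕ.^ suc l′) - + 3)

  degLe-correction : l′ ℕ.≤ e → DegLe R Bound → DegLe correction (+ 2 ℕ.^ e - + 2)
  degLe-correction l′≤e R≤Bound =
    degLe-+P (R *P a (suc m′)) (X *P (R *P S))
      (degLe-mono (R *P a (suc m′)) bound₁ (degLe-*P R (a (suc m′)) R≤Bound (degLe-a m′)))
      (degLe-mono (X *P (R *P S)) bound₂
        (degLe-*P X (R *P S) degLe-X (degLe-*P R S R≤Bound (degLe-sumProdA l′ k))))
    where
    open ℤP.≤-Reasoning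
    S : Poly
    S = sumProdA (suc l′) k
    A L : ℤ
    A = + 2 ℕ.^ e
    L = + 2 ℕ.^ suc l′
    cancel₁ : ∀ A b → A - b - + 2 + b ≡ A - + 2
    cancel₁ = solve-∀
    cancel₂ : ∀ A L → + 1 + ((L - + 3) + (A - L)) ≡ A - + 2
    cancel₂ = solve-∀
    bound₁ : Bound + + 2 ℕ.^ m′ ≤ A - + 2
    bound₁ = begin
      Bound + + 2 ℕ.^ m′                   ≤⟨ ℤP.+-monoˡ-≤ (+ 2 ℕ.^ m′) (ℤP.i⊓j≤i (A - + 2 ℕ.^ m′ - + 2) (L - + 3)) ⟩
      A - + 2 ℕ.^ m′ - + 2 + + 2 ℕ.^ m′     ≡⟨ cancel₁ A (+ 2 ℕ.^ m′) ⟩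
      A - + 2                              ∎
    bound₂ : + 1 + (Bound + (+ 2 ℕ.^ (l′ ℕ.+ k) - L)) ≤ A - + 2
    bound₂ = begin
      + 1 + (Bound + (+ 2 ℕ.^ (l′ ℕ.+ k) - L)) ≤⟨ ℤP.+-monoʳ-≤ (+ 1) (ℤP.+-monoˡ-≤ (+ 2 ℕ.^ (l′ ℕ.+ k) - L) (ℤP.i⊓j≤j (A - + 2 ℕ.^ m′ - + 2) (L - + 3))) ⟩
      + 1 + ((L - + 3) + (+ 2 ℕ.^ (l′ ℕ.+ k) - L))
        ≡⟨ cong (λ i → + 1 + ((L - + 3) + (+ 2 ℕ.^ i - L))) (ℕP.m+[n∸m]≡n l′≤e) ⟩
      + 1 + ((L - + 3) + (A - L))          ≡⟨ cancel₂ A L ⟩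
      A - + 2                              ∎

  degLt-correction : l′ ℕ.≤ e → DegLe R Bound → DegLt correction d
  degLt-correction l′≤e R≤Bound =
    degLe⇒degLt correction (degLe-correction l′≤e R≤Bound) (subst (λ A → + A - + 2 < + d) suc-d (1+n-2<n d))
    where
    1+n-2<n : ∀ n → + suc n - + 2 < + n
    1+n-2<n zero    = -<+
    1+n-2<n (suc n) = +<+ ℕP.≤-refl

open import Data.Nat using (ℕ; _≤_; _+_; _∸_; _^_)
open import Data.Integer using (ℤ; +_; _-_; _⊓_)
open import Relation.Binary.PropositionalEquality using (_≡_)

lemma3p5 : (m n l : ℕ) → 2 ≤ m → 1 ≤ n → 1 ≤ l → l ≤ m + n ∸ 1 →
    (R : Poly) →
    DegLe R (((+ (2 ^ (m + n ∸ 2)) - + (2 ^ (m ∸ 2))) - + 2) ⊓ (+ (2 ^ l) - + 3)) →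
    (r : Poly) →
    IsRemainder (R *P a l *P prodRange l (m + n ∸ 2)) (D m n) r →
    coeff r 0 ≡ + 0
lemma3p5 (suc (suc m′)) (suc n′) (suc l′) (s≤s (s≤s z≤n)) _ _ (s≤s l′≤e) R R≤Bound r H-remainder = begin
  coeff r 0             ≡⟨ Remainder.remainder-unique H Dₘₙ (R *P X) correction r d coeff-Dₘₙ-top degLt-Dₘₙ
                             H-remainder (H+correction≈RX*Dₘₙ l′≤e) (degLt-correction l′≤e R≤Bound) 0 ⟩
  - coeff correction 0  ≡⟨ cong -_ coeff-correction-0 ⟩
  + 0                   ∎
  where
  open Reduction m′ n′ l′ R
  open ≡-Reasoning
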